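{- Let $\mathcal{C} = \operatorname{Av}(312, 321)$ and for $n \ge 0$ let $p_n(t)$ be the generating function $\sum_{\pi} t^{|\pi|}$ over all permutations $\pi \in \mathcal{C}$ whose longest increasing subsequence has length exactly $n$. Then $p_0(t) = 1$, $p_1(t) = t + t^2$, and for $n \ge 2$, \[ p_n(t) = (2t + t^2)\, p_{n-1}(t) - t^2\, p_{n-2}(t). \]
   Context: $\operatorname{Av}(312,321)$ is the set of permutations (in one-line notation) containing no subsequence order-isomorphic to $312$ or to $321$. The empty permutation has longest increasing subsequence of length $0$. -}

module Defs where

open import Data.Nat as ℕ using (ℕ; zero; suc)
open import Data.Integer as ℤ using (ℤ; +_)
open import Data.Fin using (Fin; _<_)
open import Data.Vec using (Vec; []; _∷_; lookup; map)
open import Data.List using (List; length)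
open import Data.List.Membership.Propositional using (_∈_)
open import Data.List.Relation.Unary.Unique.Propositional using (Unique)
open import Data.Product using (Σ; ∃; _×_)
open import Data.Unit using (⊤)
open import Data.Bool using (true; false)
open import Relation.Nullary using (¬_)
open import Relation.Binary.PropositionalEquality using (_≡_)
open import Function.Bundles using (_⇔_)

IsPerm : ∀ {k} → Vec (Fin k) k → Set
IsPerm π = ∀ i j → lookup π i ≡ lookup π j → i ≡ j

Contains312 : ∀ {k} → Vec (Fin k) k → Set
Contains312 {k} π = Σ (Fin k) λ i → Σ (Fin k) λ j → Σ (Fin k) λ l →
  i < j × j < l × lookup π j < lookup π l × lookup π l < lookup π i

Contains321 : ∀ {k} → Vec (Fin k) k → Set
Contains321 {k} π = Σ (Fin k) λ i → Σ (Fin k) λ j → Σ (Fin k) λ l →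
  i < j × j < l × lookup π l < lookup π j × lookup π j < lookup π i

InAv312-321 : ∀ {k} → Vec (Fin k) k → Set
InAv312-321 π = IsPerm π × ¬ Contains312 π × ¬ Contains321 π

SInc : ∀ {k m} → Vec (Fin k) m → Set
SInc [] = ⊤
SInc (x ∷ []) = ⊤
SInc (x ∷ y ∷ xs) = x < y × SInc (y ∷ xs)

HasIncSub : ∀ {k} → Vec (Fin k) k → ℕ → Set
HasIncSub {k} π m = Σ (Vec (Fin k) m) λ is → SInc is × SInc (map (lookup π) is)

LIS≡ : ∀ {k} → Vec (Fin k) k → ℕ → Set
LIS≡ π n = HasIncSub π n × ¬ HasIncSub π (suc n)

HasCount : {A : Set} → (A → Set) → ℕ → Set
HasCount {A} P c = Σ (List A) λ L → Unique L × (∀ a → (a ∈ L) ⇔ P a) × length L ≡ c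

FPS : Set
FPS = ℕ → ℤ

t^_·_ : ℕ → FPS → FPS
(t^ j · f) k with k ℕ.<ᵇ j
... | true = + 0
... | false = f (k ℕ.∸ j)

_⊕_ : FPS → FPS → FPS
(f ⊕ g) k = f k ℤ.+ g k

_⊖_ : FPS → FPS → FPS
(f ⊖ g) k = f k ℤ.- g k

-- the polynomial with coefficient list cs (constant term first)
poly : List ℤ → FPS
poly Data.List.[] k = + 0
poly (c Data.List.∷ cs) zero = c
poly (c Data.List.∷ cs) (suc k) = poly cs k

IsGF-p : (ℕ → FPS) → Set
IsGF-p p = ∀ n k → Σ ℕ λ c → p n k ≡ + c ×
  HasCount (λ (π : Vec (Fin k) k) → InAv312-321 π × LIS≡ π n) c

-- In a permutation avoiding 312 and 321 no entry is followed by two smaller ones,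
-- so the maximum is the last or the penultimate entry. Deleting it is a bijection:
-- permutations of length k + 1 ending with their maximum correspond to all
-- permutations of length k, and the longest increasing subsequence drops by one;
-- permutations of length k + 2 with the maximum in penultimate position correspond
-- to all permutations of length k + 1 (the maximum is inserted before the last entry),
-- and the longest increasing subsequence drops by one unless the smaller permutation
-- ends with its own maximum. Writing a, e, d (count, countMaxLast and
-- countMaxPenultimate below) for the numbers of all permutations, of those ending
-- with their maximum, and of the others, with LIS n and length k, this gives
--   a n (k+1) = e n k + d n k,   e (n+1) k = a n k,   d (n+1) (k+1) = e (n+1) k + d n k,
-- and eliminating e and d yields the recurrence.

module Submission where

open import Data.Nat as ℕ using (ℕ; zero; suc; _+_; _∸_; _<_; _≤_; s≤s; _<?_; _≟_)
open import Data.Nat.Properties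
open import Data.Nat.Solver using (module +-*-Solver)
open import Data.Integer as ℤ using (+_)
open import Data.Integer.Properties using ([+m]-[+n]≡m⊖n; ⊖-≥)
open import Data.Fin as Fin using (Fin; toℕ; fromℕ<)
open import Data.Fin.Properties using (toℕ<n; toℕ-injective; fromℕ<-toℕ; toℕ-fromℕ<; any?; injective⇒≤)
open import Data.Vec using (Vec; []; _∷_; lookup; map; tabulate; _∷ʳ_; initLast)
open import Data.Vec.Properties using (lookup∘tabulate; tabulate∘lookup; tabulate-cong; map-∷ʳ)
open import Data.Vec.Relation.Unary.All as All using (All; []; _∷_)
open import Data.Vec.Relation.Unary.All.Properties using (map⁺; map⁻)
open import Data.List as List using (_∷_; [])
open import Data.List.Properties using (length-++; length-map)
open import Data.List.Membership.Propositional.Properties using (∈-map⁺; ∈-map⁻; ∈-++⁺ˡ; ∈-++⁺ʳ; ∈-++⁻)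
import Data.List.Relation.Unary.Unique.Propositional.Properties as Unique
import Data.List.Relation.Unary.AllPairs as AllPairs
open import Data.List.Relation.Unary.Any using (here; there)
import Data.List.Relation.Unary.All as ListAll
open import Data.Product using (Σ; _×_; _,_; proj₁; proj₂)
open import Data.Sum as ⊎ using (_⊎_; inj₁; inj₂; [_,_])
open import Data.Unit using (tt)
open import Data.Empty using (⊥-elim)
open import Relation.Nullary using (¬_; yes; no)
open import Relation.Nullary.Decidable using (toSum)
open import Relation.Binary.PropositionalEquality hiding ([_])
open import Relation.Binary.Definitions using (tri<; tri≈; tri>)
open import Function using (_∘_)
open import Function.Bundles using (_⇔_; mk⇔; Equivalence)
import Function.Properties.Equivalence as ⇔
open import Defs

<-suc-cases : ∀ {i k} → i < suc k → i < k ⊎ i ≡ k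
<-suc-cases {i} {k} i<1+k with i <? k
... | yes i<k = inj₁ i<k
... | no i≮k = inj₂ (≤-antisym (ℕ.s≤s⁻¹ i<1+k) (≮⇒≥ i≮k))

<-2+-cases : ∀ {i k} → i < suc (suc k) → i < k ⊎ i ≡ k ⊎ i ≡ suc k
<-2+-cases i<2+k with <-suc-cases i<2+k
... | inj₂ i≡1+k = inj₂ (inj₂ i≡1+k)
... | inj₁ i<1+k with <-suc-cases i<1+k
... | inj₁ i<k = inj₁ i<k
... | inj₂ i≡k = inj₂ (inj₁ i≡k)

SInc-∷ʳ⁻ : ∀ {K m} (ys : Vec (Fin K) m) {y} → SInc (ys ∷ʳ y) → SInc ys × All (Fin._< y) ys
SInc-∷ʳ⁻ [] _ = tt , []
SInc-∷ʳ⁻ (x ∷ []) (x<y , _) = tt , x<y ∷ []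
SInc-∷ʳ⁻ (x ∷ x′ ∷ ys) (x<x′ , inc) with SInc-∷ʳ⁻ (x′ ∷ ys) inc
... | inc′ , x′<y ∷ below = (x<x′ , inc′) , <-trans x<x′ x′<y ∷ x′<y ∷ below

SInc-∷ʳ⁺ : ∀ {K m} (ys : Vec (Fin K) m) {y} → SInc ys → All (Fin._< y) ys → SInc (ys ∷ʳ y)
SInc-∷ʳ⁺ [] _ _ = tt
SInc-∷ʳ⁺ (x ∷ []) _ (x<y ∷ []) = x<y , tt
SInc-∷ʳ⁺ (x ∷ x′ ∷ ys) (x<x′ , inc) (_ ∷ below) = x<x′ , SInc-∷ʳ⁺ (x′ ∷ ys) inc below

All-∷ʳ⁻ : ∀ {A : Set} {P : A → Set} {m} (ys : Vec A m) {y} → All P (ys ∷ʳ y) → All P ys × P y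
All-∷ʳ⁻ [] (py ∷ []) = [] , py
All-∷ʳ⁻ (x ∷ ys) (px ∷ pys) = let pys′ , py = All-∷ʳ⁻ ys pys in px ∷ pys′ , py

All-∷ʳ⁺ : ∀ {A : Set} {P : A → Set} {m} (ys : Vec A m) {y} → All P ys → P y → All P (ys ∷ʳ y)
All-∷ʳ⁺ [] [] py = py ∷ []
All-∷ʳ⁺ (x ∷ ys) (px ∷ pys) py = px ∷ All-∷ʳ⁺ ys pys py

×-⇔-dependent : ∀ {A A′ B B′ : Set} (eqA : A ⇔ A′) → (A → B ⇔ B′) → (A × B) ⇔ (A′ × B′)
×-⇔-dependent eqA eqB = mk⇔
  (λ (a , b) → Equivalence.to eqA a , Equivalence.to (eqB a) b)
  (λ (a′ , b′) → let a = Equivalence.from eqA a′ in a , Equivalence.from (eqB a) b′)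

module _ {A : Set} where

  HasCount-⇔ : ∀ {P Q : A → Set} {c} → (∀ a → P a ⇔ Q a) → HasCount P c → HasCount Q c
  HasCount-⇔ P⇔Q (L , unique , members , length≡c) = L , unique , (λ a → ⇔.trans (members a) (P⇔Q a)) , length≡c

  HasCount-none : ∀ {P : A → Set} → (∀ a → ¬ P a) → HasCount P 0
  HasCount-none ¬P = List.[] , AllPairs.[] , (λ a → mk⇔ (λ ()) (⊥-elim ∘ ¬P a)) , refl

  HasCount-singleton : ∀ {P : A → Set} x → (∀ a → a ≡ x ⇔ P a) → HasCount P 1
  HasCount-singleton x is-x = List.[ x ] , ListAll.[] AllPairs.∷ AllPairs.[] ,
    (λ a → ⇔.trans (mk⇔ (λ { (here a≡x) → a≡x ; (there ()) }) here) (is-x a)) , refl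

  HasCount-⊎ : ∀ {P Q : A → Set} {c d} → (∀ a → P a → ¬ Q a) → HasCount P c → HasCount Q d →
               HasCount (λ a → P a ⊎ Q a) (c + d)
  HasCount-⊎ disjoint (L , uniqueL , membersL , refl) (M , uniqueM , membersM , refl) =
    L List.++ M ,
    Unique.++⁺ uniqueL uniqueM (λ (a∈L , a∈M) → disjoint _ (to (membersL _) a∈L) (to (membersM _) a∈M)) ,
    (λ a → mk⇔ (λ a∈L++M → ⊎.map (to (membersL a)) (to (membersM a)) (∈-++⁻ L a∈L++M))
                [ (λ Pa → ∈-++⁺ˡ (from (membersL a) Pa)) , (λ Qa → ∈-++⁺ʳ L (from (membersM a) Qa)) ]) ,
    length-++ L
    where open Equivalence

  HasCount-image : ∀ {B : Set} {P : A → Set} {c} (f : A → B) → (∀ {x y} → f x ≡ f y → x ≡ y) →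
                   HasCount P c → HasCount (λ b → Σ A λ a → P a × b ≡ f a) c
  HasCount-image f f-injective (L , unique , members , refl) =
    List.map f L ,
    Unique.map⁺ f-injective unique ,
    (λ b → mk⇔ (λ b∈fL → let a , a∈L , b≡fa = ∈-map⁻ f b∈fL in a , to (members a) a∈L , b≡fa)
                (λ { (a , Pa , refl) → ∈-map⁺ f (from (members a) Pa) })) ,
    length-map f L
    where open Equivalence

Word : Set
Word = ℕ → ℕ

_≗[<_]_ : Word → ℕ → Word → Set
w ≗[< k ] w′ = ∀ {i} → i < k → w i ≡ w′ i

≗-sym : ∀ {v w k} → v ≗[< k ] w → w ≗[< k ] v
≗-sym v≗w i<k = sym (v≗w i<k)

Below : ℕ → Word → ℕ → Set
Below k w c = ∀ {i} → i < k → w i < c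

Below-init : ∀ {k w c} → Below (suc k) w c → Below k w c
Below-init below i<k = below (m<n⇒m<1+n i<k)

Bounded : ℕ → Word → Set
Bounded K w = Below K w K

-- Permutations are handled as words ℕ → ℕ, which avoids arithmetic inside Fin;
-- positions outside [0, K) are read as 0.
opaque
  toWord : ∀ {K} → Vec (Fin K) K → Word
  toWord {K} π i with i <? K
  ... | yes i<K = toℕ (lookup π (fromℕ< i<K))
  ... | no _ = 0

  toWord-lookup : ∀ {K} (π : Vec (Fin K) K) (i : Fin K) → toWord π (toℕ i) ≡ toℕ (lookup π i)
  toWord-lookup {K} π i with toℕ i <? K
  ... | yes i<K = cong (λ j → toℕ (lookup π j)) (fromℕ<-toℕ i i<K)
  ... | no i≮K = ⊥-elim (i≮K (toℕ<n i))

toWord-fromℕ< : ∀ {K} (π : Vec (Fin K) K) {i} (i<K : i < K) →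
                toWord π i ≡ toℕ (lookup π (fromℕ< i<K))
toWord-fromℕ< π {i} i<K =
  subst (λ j → toWord π j ≡ toℕ (lookup π (fromℕ< i<K))) (toℕ-fromℕ< i<K) (toWord-lookup π (fromℕ< i<K))

toWord-bounded : ∀ {K} (π : Vec (Fin K) K) → Bounded K (toWord π)
toWord-bounded π i<K rewrite toWord-fromℕ< π i<K = toℕ<n _

fromWord : ∀ K (w : Word) → Bounded K w → Vec (Fin K) K
fromWord K w bounded = tabulate (λ i → fromℕ< (bounded (toℕ<n i)))

toWord-fromWord : ∀ K w (bounded : Bounded K w) → toWord (fromWord K w bounded) ≗[< K ] w
toWord-fromWord K w bounded {i} i<K = begin
  toWord (fromWord K w bounded) i               ≡⟨ toWord-fromℕ< (fromWord K w bounded) i<K ⟩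
  toℕ (lookup (fromWord K w bounded) (fromℕ< i<K)) ≡⟨ cong toℕ (lookup∘tabulate _ (fromℕ< i<K)) ⟩
  toℕ (fromℕ< (bounded (toℕ<n (fromℕ< i<K))))     ≡⟨ toℕ-fromℕ< _ ⟩
  w (toℕ (fromℕ< i<K))                            ≡⟨ cong w (toℕ-fromℕ< i<K) ⟩
  w i                                             ∎
  where open ≡-Reasoning

toWord-injective : ∀ {K} {π π′ : Vec (Fin K) K} → toWord π ≗[< K ] toWord π′ → π ≡ π′
toWord-injective {π = π} {π′} same = begin
  π                      ≡⟨ tabulate∘lookup π ⟨
  tabulate (lookup π)    ≡⟨ tabulate-cong (λ j → toℕ-injective (begin
                              toℕ (lookup π j)   ≡⟨ toWord-lookup π j ⟨
                              toWord π (toℕ j)   ≡⟨ same (toℕ<n j) ⟩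
                              toWord π′ (toℕ j)  ≡⟨ toWord-lookup π′ j ⟩
                              toℕ (lookup π′ j)  ∎)) ⟩
  tabulate (lookup π′)   ≡⟨ tabulate∘lookup π′ ⟩
  π′                     ∎
  where open ≡-Reasoning

-- IncSub w k m b: the prefix w 0, …, w (k - 1) has an increasing subsequence
-- of length m all of whose values are < b.
data IncSub (w : Word) : ℕ → ℕ → ℕ → Set where
  nil  : ∀ {k b} → IncSub w k 0 b
  skip : ∀ {k m b} → IncSub w k m b → IncSub w (suc k) m b
  keep : ∀ {k m b} → w k < b → IncSub w k m (w k) → IncSub w (suc k) (suc m) b

IncSub-raise : ∀ {w k m b b′} → b ≤ b′ → IncSub w k m b → IncSub w k m b′
IncSub-raise b≤b′ nil = nil
IncSub-raise b≤b′ (skip s) = skip (IncSub-raise b≤b′ s)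
IncSub-raise b≤b′ (keep wk<b s) = keep (<-≤-trans wk<b b≤b′) s

IncSub-rebound : ∀ {w k m b c} → Below k w c → IncSub w k m b → IncSub w k m c
IncSub-rebound below nil = nil
IncSub-rebound below (skip s) = skip (IncSub-rebound (Below-init below) s)
IncSub-rebound below (keep _ s) = keep (below ≤-refl) s

IncSub-shorten : ∀ {w k m b} → IncSub w k (suc m) b → IncSub w k m b
IncSub-shorten (skip s) = skip (IncSub-shorten s)
IncSub-shorten (keep wk<b s) = skip (IncSub-raise (<⇒≤ wk<b) s)

IncSub-cong : ∀ {w w′ k m b} → w ≗[< k ] w′ → IncSub w k m b → IncSub w′ k m b
IncSub-cong same nil = nil
IncSub-cong same (skip s) = skip (IncSub-cong (λ i<k → same (m<n⇒m<1+n i<k)) s)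
IncSub-cong {w} {w′} {suc k} same (keep wk<b s) =
  keep (subst (_< _) wk≡w′k wk<b)
       (subst (IncSub w′ k _) wk≡w′k (IncSub-cong (λ i<k → same (m<n⇒m<1+n i<k)) s))
  where wk≡w′k = same (≤-refl {suc k})

IncSub-dropLast : ∀ {w k m b c} → Below k w c → IncSub w (suc k) (suc m) b → IncSub w k m c
IncSub-dropLast below (skip s) = IncSub-rebound below (IncSub-shorten s)
IncSub-dropLast below (keep _ s) = IncSub-rebound below s

IncSub-keepTop : ∀ {w k m b b′} → Below k w (w k) → w k < b′ → IncSub w k m b → IncSub w (suc k) (suc m) b′
IncSub-keepTop top wk<b′ s = keep wk<b′ (IncSub-rebound top s)

-- An increasing subsequence cannot use both the prefix maximum w k and the
-- smaller entry w (k + 1) after it, and the latter can be traded for the former.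
IncSub-skipDescent : ∀ {w k m b} → Below k w (w k) → w (suc k) < w k → w k < b →
                     IncSub w (suc (suc k)) m b → IncSub w (suc k) m b
IncSub-skipDescent top descent wk<b nil = nil
IncSub-skipDescent top descent wk<b (skip s) = s
IncSub-skipDescent top descent wk<b (keep _ nil) = keep wk<b nil
IncSub-skipDescent top descent wk<b (keep _ (skip s)) = keep wk<b (IncSub-rebound top s)
IncSub-skipDescent top descent wk<b (keep _ (keep wk<w1+k _)) = ⊥-elim (<-asym descent wk<w1+k)

IncSub-swapTop : ∀ {v w k m b b′} → v ≗[< k ] w → Below k w (w k) → w k < b′ →
                 IncSub v (suc k) m b → IncSub w (suc k) m b′
IncSub-swapTop v≗w top wk<b′ nil = nil
IncSub-swapTop v≗w top wk<b′ (skip s) =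
  skip (IncSub-rebound (λ i<k → <-trans (top i<k) wk<b′) (IncSub-cong v≗w s))
IncSub-swapTop v≗w top wk<b′ (keep _ s) = keep wk<b′ (IncSub-rebound top (IncSub-cong v≗w s))

module _ {K} (π : Vec (Fin K) K) where

  IncWitness : ℕ → ℕ → ∀ {m} → Vec (Fin K) m → Set
  IncWitness k b xs = SInc xs × SInc (map (lookup π) xs) ×
                      All (λ x → toℕ x < k) xs × All (λ x → toℕ (lookup π x) < b) xs

  witness⇒IncSub : ∀ k {m b} (xs : Vec (Fin K) m) → IncWitness k b xs → IncSub (toWord π) k m b
  witness⇒IncSub k [] _ = nil
  witness⇒IncSub zero (x ∷ _) (_ , _ , () ∷ _ , _)
  witness⇒IncSub (suc k) {suc m} xs (inc , vinc , pos , val) with initLast xs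
  ... | ys , y , refl
    with SInc-∷ʳ⁻ ys inc | All-∷ʳ⁻ ys pos | All-∷ʳ⁻ ys val
       | SInc-∷ʳ⁻ (map (lookup π) ys) (subst SInc (map-∷ʳ (lookup π) y ys) vinc)
  ... | inc′ , ys<y | _ , y<1+k | _ , πy<b | vinc′ , πys<πy with <-suc-cases y<1+k
  ... | inj₁ y<k = skip (witness⇒IncSub k (ys ∷ʳ y)
          (inc , vinc , All-∷ʳ⁺ ys (All.map (λ x<y → <-trans x<y y<k) ys<y) y<k , val))
  ... | inj₂ refl = keep (subst (_< _) (sym (toWord-lookup π y)) πy<b)
          (witness⇒IncSub (toℕ y) ys
            (inc′ , vinc′ , ys<y , All.map (subst (_ <_) (sym (toWord-lookup π y))) (map⁻ πys<πy)))

  IncSub⇒witness : ∀ {k m b} → k ≤ K → IncSub (toWord π) k m b → Σ (Vec (Fin K) m) (IncWitness k b)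
  IncSub⇒witness _ nil = [] , tt , tt , [] , []
  IncSub⇒witness k≤K (skip s) with IncSub⇒witness (<⇒≤ k≤K) s
  ... | xs , inc , vinc , pos , val = xs , inc , vinc , All.map m<n⇒m<1+n pos , val
  IncSub⇒witness {suc k} k<K (keep wk<b s) with IncSub⇒witness (<⇒≤ k<K) s
  ... | xs , inc , vinc , pos , val =
    xs ∷ʳ y ,
    SInc-∷ʳ⁺ xs inc (All.map (subst (_ <_) (sym y≡k)) pos) ,
    subst SInc (sym (map-∷ʳ (lookup π) y xs))
      (SInc-∷ʳ⁺ (map (lookup π) xs) vinc (map⁺ (All.map (subst (_ <_) wk≡πy) val))) ,
    All-∷ʳ⁺ xs (All.map m<n⇒m<1+n pos) (s≤s (≤-reflexive y≡k)) ,
    All-∷ʳ⁺ xs (All.map (λ v<wk → <-trans v<wk wk<b) val) (subst (_< _) wk≡πy wk<b)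
    where
      y = fromℕ< k<K
      y≡k = toℕ-fromℕ< k<K
      wk≡πy = toWord-fromℕ< π k<K

  HasIncSub⇔IncSub : ∀ {m} → HasIncSub π m ⇔ IncSub (toWord π) K m K
  HasIncSub⇔IncSub = mk⇔
    (λ (xs , inc , vinc) → witness⇒IncSub K xs
       (inc , vinc , All.universal toℕ<n xs , All.universal (λ x → toℕ<n (lookup π x)) xs))
    (λ s → let xs , inc , vinc , _ = IncSub⇒witness ≤-refl s in xs , inc , vinc)

HasIncSub-⇔ : ∀ {k k′ m m′} (π : Vec (Fin k) k) (π′ : Vec (Fin k′) k′) →
              IncSub (toWord π) k m k ⇔ IncSub (toWord π′) k′ m′ k′ → HasIncSub π m ⇔ HasIncSub π′ m′
HasIncSub-⇔ π π′ eq = ⇔.trans (HasIncSub⇔IncSub π) (⇔.trans eq (⇔.sym (HasIncSub⇔IncSub π′)))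

LIS≡-transfer : ∀ {k k′ n n′} {π : Vec (Fin k) k} {σ : Vec (Fin k′) k′} →
                HasIncSub π n ⇔ HasIncSub σ n′ → HasIncSub π (suc n) ⇔ HasIncSub σ (suc n′) →
                LIS≡ π n ⇔ LIS≡ σ n′
LIS≡-transfer same same-suc = mk⇔
  (λ (has , ¬longer) → Equivalence.to same has , λ longer → ¬longer (Equivalence.from same-suc longer))
  (λ (has , ¬longer) → Equivalence.from same has , λ longer → ¬longer (Equivalence.to same-suc longer))

InjectiveOn : ℕ → Word → Set
InjectiveOn K w = ∀ {i j} → i < K → j < K → w i ≡ w j → i ≡ j

-- The patterns 312 and 321 are exactly those whose first entry exceeds the other two.
TwoSmallerAfter : ℕ → Word → Set
TwoSmallerAfter K w = Σ ℕ λ i → Σ ℕ λ j → Σ ℕ λ l →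
  i < j × j < l × l < K × w j < w i × w l < w i

Av : ℕ → Word → Set
Av K w = InjectiveOn K w × ¬ TwoSmallerAfter K w

module _ {K} (π : Vec (Fin K) K) where
  private
    w = toWord π

    fromℕ<-mono : ∀ {i j} (i<K : i < K) (j<K : j < K) → i < j → fromℕ< i<K Fin.< fromℕ< j<K
    fromℕ<-mono i<K j<K = subst₂ _<_ (sym (toℕ-fromℕ< i<K)) (sym (toℕ-fromℕ< j<K))

    lookup-mono : ∀ {i j} (i<K : i < K) (j<K : j < K) → w i < w j →
                  lookup π (fromℕ< i<K) Fin.< lookup π (fromℕ< j<K)
    lookup-mono i<K j<K = subst₂ _<_ (toWord-fromℕ< π i<K) (toWord-fromℕ< π j<K)

    toWord-mono : ∀ {i j} → lookup π i Fin.< lookup π j → w (toℕ i) < w (toℕ j)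
    toWord-mono = subst₂ _<_ (sym (toWord-lookup π _)) (sym (toWord-lookup π _))

  InAv⇒Av : InAv312-321 π → Av K w
  InAv⇒Av (perm , ¬312 , ¬321) = injective , ¬twoSmaller
    where
      injective : InjectiveOn K w
      injective i<K j<K wi≡wj = begin
        _                   ≡⟨ toℕ-fromℕ< i<K ⟨
        toℕ (fromℕ< i<K)   ≡⟨ cong toℕ (perm _ _ (toℕ-injective (begin
          toℕ (lookup π (fromℕ< i<K)) ≡⟨ toWord-fromℕ< π i<K ⟨
          w _                         ≡⟨ wi≡wj ⟩
          w _                         ≡⟨ toWord-fromℕ< π j<K ⟩
          toℕ (lookup π (fromℕ< j<K)) ∎))) ⟩
        toℕ (fromℕ< j<K)   ≡⟨ toℕ-fromℕ< j<K ⟩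
        _                   ∎
        where open ≡-Reasoning
      ¬twoSmaller : ¬ TwoSmallerAfter K w
      ¬twoSmaller (i , j , l , i<j , j<l , l<K , wj<wi , wl<wi) with <-cmp (w j) (w l)
      ... | tri< wj<wl _ _ = ¬312 (fromℕ< i<K , fromℕ< j<K , fromℕ< l<K ,
              fromℕ<-mono i<K j<K i<j , fromℕ<-mono j<K l<K j<l ,
              lookup-mono j<K l<K wj<wl , lookup-mono l<K i<K wl<wi)
        where j<K = <-trans j<l l<K
              i<K = <-trans i<j j<K
      ... | tri≈ _ wj≡wl _ = <-irrefl (injective (<-trans j<l l<K) l<K wj≡wl) j<l
      ... | tri> _ _ wl<wj = ¬321 (fromℕ< i<K , fromℕ< j<K , fromℕ< l<K ,
              fromℕ<-mono i<K j<K i<j , fromℕ<-mono j<K l<K j<l ,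
              lookup-mono l<K j<K wl<wj , lookup-mono j<K i<K wj<wi)
        where j<K = <-trans j<l l<K
              i<K = <-trans i<j j<K

  Av⇒InAv : Av K w → InAv312-321 π
  Av⇒InAv (injective , ¬twoSmaller) = perm , ¬312 , ¬321
    where
      perm : IsPerm π
      perm i j πi≡πj = toℕ-injective (injective (toℕ<n i) (toℕ<n j)
        (trans (toWord-lookup π i) (trans (cong toℕ πi≡πj) (sym (toWord-lookup π j)))))
      ¬312 : ¬ Contains312 π
      ¬312 (i , j , l , i<j , j<l , πj<πl , πl<πi) = ¬twoSmaller (toℕ i , toℕ j , toℕ l , i<j , j<l , toℕ<n l ,
        toWord-mono (<-trans πj<πl πl<πi) , toWord-mono πl<πi)
      ¬321 : ¬ Contains321 π
      ¬321 (i , j , l , i<j , j<l , πl<πj , πj<πi) = ¬twoSmaller (toℕ i , toℕ j , toℕ l , i<j , j<l , toℕ<n l ,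
        toWord-mono πj<πi , toWord-mono (<-trans πl<πj πj<πi))

Av-subsequence : ∀ {K K′ w w′} (f : ℕ → ℕ) →
                 (∀ {i j} → i < j → j < K′ → f i < f j) → Below K′ f K → w′ ≗[< K′ ] (w ∘ f) →
                 Av K w → Av K′ w′
Av-subsequence {K} {K′} {w} {w′} f f-mono f-below w′≗wf (injective , ¬twoSmaller) = injective′ , ¬twoSmaller′
  where
    injective′ : InjectiveOn K′ w′
    injective′ {i} {j} i<K′ j<K′ w′i≡w′j with <-cmp i j
    ... | tri< i<j _ _ = ⊥-elim (<-irrefl (injective (f-below i<K′) (f-below j<K′) wfi≡wfj) (f-mono i<j j<K′))
      where wfi≡wfj = trans (sym (w′≗wf i<K′)) (trans w′i≡w′j (w′≗wf j<K′))
    ... | tri≈ _ i≡j _ = i≡j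
    ... | tri> _ _ j<i = ⊥-elim (<-irrefl (injective (f-below j<K′) (f-below i<K′) wfj≡wfi) (f-mono j<i i<K′))
      where wfj≡wfi = trans (sym (w′≗wf j<K′)) (trans (sym w′i≡w′j) (w′≗wf i<K′))
    ¬twoSmaller′ : ¬ TwoSmallerAfter K′ w′
    ¬twoSmaller′ (i , j , l , i<j , j<l , l<K′ , w′j<w′i , w′l<w′i) =
      ¬twoSmaller (f i , f j , f l , f-mono i<j j<K′ , f-mono j<l l<K′ , f-below l<K′ ,
                   subst₂ _<_ (w′≗wf j<K′) (w′≗wf i<K′) w′j<w′i ,
                   subst₂ _<_ (w′≗wf l<K′) (w′≗wf i<K′) w′l<w′i)
      where j<K′ = <-trans j<l l<K′
            i<K′ = <-trans i<j j<K′

others-below-max : ∀ {w k p i} → InjectiveOn (suc k) w → Bounded (suc k) w → p < suc k → w p ≡ k →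
                   i < suc k → i ≢ p → w i < k
others-below-max injective bounded p<1+k wp≡k i<1+k i≢p with <-suc-cases (bounded i<1+k)
... | inj₁ wi<k = wi<k
... | inj₂ wi≡k = ⊥-elim (i≢p (injective i<1+k p<1+k (trans wi≡k (sym wp≡k))))

max-attained : ∀ {w k} → InjectiveOn (suc k) w → Bounded (suc k) w → Σ ℕ λ p → p < suc k × w p ≡ k
max-attained {w} {k} injective bounded with any? {n = suc k} (λ i → w (toℕ i) ≟ k)
... | yes (i , wi≡k) = toℕ i , toℕ<n i , wi≡k
... | no ¬attained = ⊥-elim (<-irrefl refl (injective⇒≤ squeeze-injective))
  where
    below : (i : Fin (suc k)) → w (toℕ i) < k
    below i with <-suc-cases (bounded (toℕ<n i))
    ... | inj₁ wi<k = wi<k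
    ... | inj₂ wi≡k = ⊥-elim (¬attained (i , wi≡k))
    squeeze : Fin (suc k) → Fin k
    squeeze i = fromℕ< (below i)
    squeeze-injective : ∀ {i j} → squeeze i ≡ squeeze j → i ≡ j
    squeeze-injective {i} {j} eq = toℕ-injective (injective (toℕ<n i) (toℕ<n j)
      (trans (sym (toℕ-fromℕ< (below i))) (trans (cong toℕ eq) (toℕ-fromℕ< (below j)))))

-- Anything after the maximum is smaller than it, so at most one entry follows it.
max-penultimate : ∀ {w k} → Av (suc (suc k)) w → Bounded (suc (suc k)) w → w (suc k) ≢ suc k →
                  w k ≡ suc k
max-penultimate {w} {k} (injective , ¬twoSmaller) bounded ¬last with max-attained injective bounded
... | p , p<2+k , wp≡1+k with <-suc-cases p<2+k
... | inj₂ refl = ⊥-elim (¬last wp≡1+k)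
... | inj₁ p<1+k with <-suc-cases p<1+k
... | inj₂ refl = wp≡1+k
... | inj₁ p<k = ⊥-elim (¬twoSmaller (p , suc p , suc (suc p) , ≤-refl , ≤-refl , s≤s (s≤s p<k) ,
        after-max (s≤s p<1+k) (λ ()) , after-max (s≤s (s≤s p<k)) (λ ())))
  where
    after-max : ∀ {i} → i < suc (suc k) → i ≢ p → w i < w p
    after-max i<2+k i≢p = subst (w _ <_) (sym wp≡1+k)
      (others-below-max injective bounded p<2+k wp≡1+k i<2+k i≢p)

opaque
  extend : Word → ℕ → ℕ → Word
  extend w k v i with i <? k
  ... | yes _ = w i
  ... | no _ = v

  extend-< : ∀ w k v {i} → i < k → extend w k v i ≡ w i
  extend-< w k v {i} i<k with i <? k
  ... | yes _ = refl
  ... | no i≮k = ⊥-elim (i≮k i<k)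

  extend-at : ∀ w k v → extend w k v k ≡ v
  extend-at w k v with k <? k
  ... | yes k<k = ⊥-elim (<-irrefl refl k<k)
  ... | no _ = refl

AppendsMax : ℕ → Word → Word → Set
AppendsMax k w v = v ≗[< k ] w × v k ≡ k

InsertsMax : ℕ → Word → Word → Set
InsertsMax k w v = v ≗[< k ] w × v k ≡ suc k × v (suc k) ≡ w k

AppendsMax-functional : ∀ {k w v v′} → AppendsMax k w v → AppendsMax k w v′ → v ≗[< suc k ] v′
AppendsMax-functional (v≗w , vk≡k) (v′≗w , v′k≡k) i<1+k with <-suc-cases i<1+k
... | inj₁ i<k = trans (v≗w i<k) (sym (v′≗w i<k))
... | inj₂ refl = trans vk≡k (sym v′k≡k)

AppendsMax-injective : ∀ {k w w′ v} → AppendsMax k w v → AppendsMax k w′ v → w ≗[< k ] w′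
AppendsMax-injective (v≗w , _) (v≗w′ , _) i<k = trans (sym (v≗w i<k)) (v≗w′ i<k)

InsertsMax-functional : ∀ {k w v v′} → InsertsMax k w v → InsertsMax k w v′ → v ≗[< suc (suc k) ] v′
InsertsMax-functional (v≗w , vk≡1+k , v1+k≡wk) (v′≗w , v′k≡1+k , v′1+k≡wk) i<2+k with <-2+-cases i<2+k
... | inj₁ i<k = trans (v≗w i<k) (sym (v′≗w i<k))
... | inj₂ (inj₁ refl) = trans vk≡1+k (sym v′k≡1+k)
... | inj₂ (inj₂ refl) = trans v1+k≡wk (sym v′1+k≡wk)

InsertsMax-injective : ∀ {k w w′ v} → InsertsMax k w v → InsertsMax k w′ v → w ≗[< suc k ] w′
InsertsMax-injective (v≗w , _ , v1+k≡wk) (v≗w′ , _ , v1+k≡w′k) i<1+k with <-suc-cases i<1+k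
... | inj₁ i<k = trans (sym (v≗w i<k)) (v≗w′ i<k)
... | inj₂ refl = trans (sym v1+k≡wk) v1+k≡w′k

AppendsMax-Av : ∀ {k w v} → AppendsMax k w v → Bounded k w → Av k w → Av (suc k) v
AppendsMax-Av {k} {w} {v} (v≗w , vk≡k) bounded (injective , ¬twoSmaller) = injective′ , ¬twoSmaller′
  where
    v-below : Below k v k
    v-below i<k = subst (_< k) (sym (v≗w i<k)) (bounded i<k)
    injective′ : InjectiveOn (suc k) v
    injective′ i<1+k j<1+k vi≡vj with <-suc-cases i<1+k | <-suc-cases j<1+k
    ... | inj₁ i<k | inj₁ j<k = injective i<k j<k (trans (sym (v≗w i<k)) (trans vi≡vj (v≗w j<k)))
    ... | inj₁ i<k | inj₂ refl = ⊥-elim (<-irrefl (trans vi≡vj vk≡k) (v-below i<k))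
    ... | inj₂ refl | inj₁ j<k = ⊥-elim (<-irrefl (trans (sym vi≡vj) vk≡k) (v-below j<k))
    ... | inj₂ refl | inj₂ refl = refl
    ¬twoSmaller′ : ¬ TwoSmallerAfter (suc k) v
    ¬twoSmaller′ (i , j , l , i<j , j<l , l<1+k , vj<vi , vl<vi) with <-suc-cases l<1+k
    ... | inj₁ l<k = ¬twoSmaller (i , j , l , i<j , j<l , l<k ,
            subst₂ _<_ (v≗w j<k) (v≗w i<k) vj<vi , subst₂ _<_ (v≗w l<k) (v≗w i<k) vl<vi)
      where j<k = <-trans j<l l<k
            i<k = <-trans i<j j<k
    ... | inj₂ refl = <-asym (subst (_< v i) vk≡k vl<vi) (v-below (<-trans i<j j<l))

InsertsMax-Av : ∀ {k w v} → InsertsMax k w v → Bounded (suc k) w → Av (suc k) w → Av (suc (suc k)) v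
InsertsMax-Av {k} {w} {v} (v≗w , vk≡1+k , v1+k≡wk) bounded (injective , ¬twoSmaller) =
  injective′ , ¬twoSmaller′
  where
    prefix-below : Below k v (suc k)
    prefix-below i<k = subst (_< suc k) (sym (v≗w i<k)) (bounded (m<n⇒m<1+n i<k))
    last-below : v (suc k) < suc k
    last-below = subst (_< suc k) (sym v1+k≡wk) (bounded ≤-refl)
    prefix≢last : ∀ {i} → i < k → v i ≢ v (suc k)
    prefix≢last i<k vi≡v1+k = <-irrefl (injective (m<n⇒m<1+n i<k) ≤-refl
      (trans (sym (v≗w i<k)) (trans vi≡v1+k v1+k≡wk))) i<k
    injective′ : InjectiveOn (suc (suc k)) v
    injective′ i<2+k j<2+k vi≡vj with <-2+-cases i<2+k | <-2+-cases j<2+k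
    ... | inj₁ i<k | inj₁ j<k =
      injective (m<n⇒m<1+n i<k) (m<n⇒m<1+n j<k) (trans (sym (v≗w i<k)) (trans vi≡vj (v≗w j<k)))
    ... | inj₁ i<k | inj₂ (inj₁ refl) = ⊥-elim (<-irrefl (trans vi≡vj vk≡1+k) (prefix-below i<k))
    ... | inj₁ i<k | inj₂ (inj₂ refl) = ⊥-elim (prefix≢last i<k vi≡vj)
    ... | inj₂ (inj₁ refl) | inj₁ j<k = ⊥-elim (<-irrefl (trans (sym vi≡vj) vk≡1+k) (prefix-below j<k))
    ... | inj₂ (inj₁ refl) | inj₂ (inj₁ refl) = refl
    ... | inj₂ (inj₁ refl) | inj₂ (inj₂ refl) = ⊥-elim (<-irrefl (trans (sym vi≡vj) vk≡1+k) last-below)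
    ... | inj₂ (inj₂ refl) | inj₁ j<k = ⊥-elim (prefix≢last j<k (sym vi≡vj))
    ... | inj₂ (inj₂ refl) | inj₂ (inj₁ refl) = ⊥-elim (<-irrefl (trans vi≡vj vk≡1+k) last-below)
    ... | inj₂ (inj₂ refl) | inj₂ (inj₂ refl) = refl
    ¬twoSmaller′ : ¬ TwoSmallerAfter (suc (suc k)) v
    ¬twoSmaller′ (i , j , l , i<j , j<l , l<2+k , vj<vi , vl<vi)
      with <-suc-cases (<-≤-trans j<l (ℕ.s≤s⁻¹ l<2+k))
    ... | inj₂ refl = <-asym (subst (_< v i) vk≡1+k vj<vi) (prefix-below i<j)
    ... | inj₁ j<k with <-2+-cases l<2+k
    ... | inj₁ l<k = ¬twoSmaller (i , j , l , i<j , j<l , m<n⇒m<1+n l<k ,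
            subst₂ _<_ (v≗w j<k) (v≗w i<k) vj<vi , subst₂ _<_ (v≗w l<k) (v≗w i<k) vl<vi)
      where i<k = <-trans i<j j<k
    ... | inj₂ (inj₁ refl) = <-asym (subst (_< v i) vk≡1+k vl<vi) (prefix-below (<-trans i<j j<k))
    ... | inj₂ (inj₂ refl) = ¬twoSmaller (i , j , k , i<j , j<k , ≤-refl ,
            subst₂ _<_ (v≗w j<k) (v≗w i<k) vj<vi , subst₂ _<_ v1+k≡wk (v≗w i<k) vl<vi)
      where i<k = <-trans i<j j<k

AppendsMax-IncSub : ∀ {k w v m} → AppendsMax k w v → Bounded k w →
                    IncSub w k m k ⇔ IncSub v (suc k) (suc m) (suc k)
AppendsMax-IncSub {k} {w} {v} (v≗w , vk≡k) bounded = mk⇔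
  (λ s → IncSub-keepTop (subst (Below k v) (sym vk≡k) v-below) (subst (_< suc k) (sym vk≡k) ≤-refl)
           (IncSub-cong (≗-sym v≗w) s))
  (λ s → IncSub-cong v≗w (IncSub-dropLast v-below s))
  where
    v-below : Below k v k
    v-below i<k = subst (_< k) (sym (v≗w i<k)) (bounded i<k)

InsertsMax-IncSub-maxLast : ∀ {k w v m} → InsertsMax k w v → Av (suc k) w → Bounded (suc k) w → w k ≡ k →
                            IncSub w (suc k) m (suc k) ⇔ IncSub v (suc (suc k)) m (suc (suc k))
InsertsMax-IncSub-maxLast {k} {w} {v} (v≗w , vk≡1+k , v1+k≡wk) (injective , _) bounded wk≡k = mk⇔
  (λ s → skip (IncSub-swapTop (≗-sym v≗w) v-top (subst (_< suc (suc k)) (sym vk≡1+k) ≤-refl) s))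
  (λ s → IncSub-swapTop v≗w w-top (subst (_< suc k) (sym wk≡k) ≤-refl)
           (IncSub-skipDescent v-top descent (subst (_< suc (suc k)) (sym vk≡1+k) ≤-refl) s))
  where
    w-below : Below k w k
    w-below i<k = others-below-max injective bounded ≤-refl wk≡k (m<n⇒m<1+n i<k) (<⇒≢ i<k)
    w-top : Below k w (w k)
    w-top = subst (Below k w) (sym wk≡k) w-below
    v-top : Below k v (v k)
    v-top i<k = subst₂ _<_ (sym (v≗w i<k)) (sym vk≡1+k) (m<n⇒m<1+n (w-below i<k))
    descent : v (suc k) < v k
    descent = subst₂ _<_ (sym v1+k≡wk) (sym vk≡1+k) (subst (_< suc k) (sym wk≡k) ≤-refl)

InsertsMax-IncSub-maxPenultimate :
  ∀ {j w v m} → InsertsMax (suc j) w v → Av (suc (suc j)) w → Bounded (suc (suc j)) w → w (suc j) ≢ suc j →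
  IncSub w (suc (suc j)) m (suc (suc j)) ⇔ IncSub v (suc (suc (suc j))) (suc m) (suc (suc (suc j)))
InsertsMax-IncSub-maxPenultimate {j} {w} {v} (v≗w , v1+j≡2+j , v2+j≡w1+j) av@(injective , _) bounded ¬maxLast =
  mk⇔
  (λ s → skip (IncSub-keepTop v-top (subst (_< _) (sym v1+j≡2+j) ≤-refl)
           (IncSub-cong (≗-sym v≗w) (IncSub-skipDescent w-top w-descent (subst (_< _) (sym wj≡1+j) ≤-refl) s))))
  (λ s → skip (IncSub-cong v≗w (IncSub-dropLast v-below
           (IncSub-skipDescent v-top v-descent (subst (_< _) (sym v1+j≡2+j) ≤-refl) s))))
  where
    wj≡1+j : w j ≡ suc j
    wj≡1+j = max-penultimate av bounded ¬maxLast
    below-max : ∀ {i} → i < suc (suc j) → i ≢ j → w i < suc j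
    below-max i<2+j i≢j = others-below-max injective bounded (m<n⇒m<1+n ≤-refl) wj≡1+j i<2+j i≢j
    w-top : Below j w (w j)
    w-top {i} i<j = subst (w i <_) (sym wj≡1+j) (below-max (m<n⇒m<1+n (m<n⇒m<1+n i<j)) (<⇒≢ i<j))
    w-descent : w (suc j) < w j
    w-descent = subst (w (suc j) <_) (sym wj≡1+j) (below-max ≤-refl (λ ()))
    v-below : Below (suc j) v (suc (suc j))
    v-below i<1+j = subst (_< _) (sym (v≗w i<1+j)) (bounded (m<n⇒m<1+n i<1+j))
    v-top : Below (suc j) v (v (suc j))
    v-top = subst (Below (suc j) v) (sym v1+j≡2+j) v-below
    v-descent : v (suc (suc j)) < v (suc j)
    v-descent = subst₂ _<_ (sym v2+j≡w1+j) (sym v1+j≡2+j) (m<n⇒m<1+n (below-max ≤-refl (λ ())))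

appendMax-word : ∀ {k} → Vec (Fin k) k → Word
appendMax-word {k} σ = extend (toWord σ) k k

appendMax-word-bounded : ∀ {k} (σ : Vec (Fin k) k) → Bounded (suc k) (appendMax-word σ)
appendMax-word-bounded {k} σ i<1+k with <-suc-cases i<1+k
... | inj₁ i<k = subst (_< suc k) (sym (extend-< _ k k i<k)) (m<n⇒m<1+n (toWord-bounded σ i<k))
... | inj₂ refl = subst (_< suc k) (sym (extend-at _ k k)) ≤-refl

appendMax : ∀ {k} → Vec (Fin k) k → Vec (Fin (suc k)) (suc k)
appendMax {k} σ = fromWord (suc k) (appendMax-word σ) (appendMax-word-bounded σ)

appendMax-AppendsMax : ∀ {k} (σ : Vec (Fin k) k) → AppendsMax k (toWord σ) (toWord (appendMax σ))
appendMax-AppendsMax {k} σ =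
  (λ i<k → trans (same (m<n⇒m<1+n i<k)) (extend-< _ k k i<k)) , trans (same ≤-refl) (extend-at _ k k)
  where same = toWord-fromWord (suc k) (appendMax-word σ) (appendMax-word-bounded σ)

insertMax-word : ∀ {k} → Vec (Fin (suc k)) (suc k) → Word
insertMax-word {k} σ = extend (extend (toWord σ) k (suc k)) (suc k) (toWord σ k)

insertMax-word-InsertsMax : ∀ {k} (σ : Vec (Fin (suc k)) (suc k)) → InsertsMax k (toWord σ) (insertMax-word σ)
insertMax-word-InsertsMax {k} σ =
  (λ i<k → trans (extend-< _ (suc k) _ (m<n⇒m<1+n i<k)) (extend-< _ k _ i<k)) ,
  trans (extend-< _ (suc k) _ ≤-refl) (extend-at _ k _) ,
  extend-at _ (suc k) _

insertMax-word-bounded : ∀ {k} (σ : Vec (Fin (suc k)) (suc k)) → Bounded (suc (suc k)) (insertMax-word σ)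
insertMax-word-bounded {k} σ i<2+k with <-2+-cases i<2+k | insertMax-word-InsertsMax σ
... | inj₁ i<k | v≗w , _ = subst (_< _) (sym (v≗w i<k)) (m<n⇒m<1+n (toWord-bounded σ (m<n⇒m<1+n i<k)))
... | inj₂ (inj₁ refl) | _ , vk≡1+k , _ = subst (_< _) (sym vk≡1+k) ≤-refl
... | inj₂ (inj₂ refl) | _ , _ , v1+k≡wk = subst (_< _) (sym v1+k≡wk) (m<n⇒m<1+n (toWord-bounded σ ≤-refl))

insertMax : ∀ {k} → Vec (Fin (suc k)) (suc k) → Vec (Fin (suc (suc k))) (suc (suc k))
insertMax {k} σ = fromWord (suc (suc k)) (insertMax-word σ) (insertMax-word-bounded σ)

insertMax-InsertsMax : ∀ {k} (σ : Vec (Fin (suc k)) (suc k)) → InsertsMax k (toWord σ) (toWord (insertMax σ))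
insertMax-InsertsMax {k} σ =
  let v≗w , vk≡1+k , v1+k≡wk = insertMax-word-InsertsMax σ
      same = toWord-fromWord (suc (suc k)) (insertMax-word σ) (insertMax-word-bounded σ)
  in (λ i<k → trans (same (m<n⇒m<1+n (m<n⇒m<1+n i<k))) (v≗w i<k)) ,
     trans (same (m<n⇒m<1+n ≤-refl)) vk≡1+k ,
     trans (same ≤-refl) v1+k≡wk

appendMax-injective : ∀ {k} {σ σ′ : Vec (Fin k) k} → appendMax σ ≡ appendMax σ′ → σ ≡ σ′
appendMax-injective {k} {σ} {σ′} eq = toWord-injective (AppendsMax-injective
  (appendMax-AppendsMax σ) (subst (AppendsMax k (toWord σ′) ∘ toWord) (sym eq) (appendMax-AppendsMax σ′)))

insertMax-injective : ∀ {k} {σ σ′ : Vec (Fin (suc k)) (suc k)} → insertMax σ ≡ insertMax σ′ → σ ≡ σ′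
insertMax-injective {k} {σ} {σ′} eq = toWord-injective (InsertsMax-injective
  (insertMax-InsertsMax σ) (subst (InsertsMax k (toWord σ′) ∘ toWord) (sym eq) (insertMax-InsertsMax σ′)))

EndsWithMax : ∀ {k} → Vec (Fin (suc k)) (suc k) → Set
EndsWithMax {k} π = toWord π k ≡ k

EndsWithMax-singleton : (π : Vec (Fin 1) 1) → EndsWithMax π
EndsWithMax-singleton π = n<1⇒n≡0 (toWord-bounded π ≤-refl)

appendMax-EndsWithMax : ∀ {k} (σ : Vec (Fin k) k) → EndsWithMax (appendMax σ)
appendMax-EndsWithMax σ = proj₂ (appendMax-AppendsMax σ)

insertMax-¬EndsWithMax : ∀ {k} (σ : Vec (Fin (suc k)) (suc k)) → ¬ EndsWithMax (insertMax σ)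
insertMax-¬EndsWithMax {k} σ endsWithMax = <-irrefl (trans (sym v1+k≡wk) endsWithMax) (toWord-bounded σ ≤-refl)
  where v1+k≡wk = proj₂ (proj₂ (insertMax-InsertsMax σ))

appendMax-InAv : ∀ {k} (σ : Vec (Fin k) k) → InAv312-321 σ ⇔ InAv312-321 (appendMax σ)
appendMax-InAv {k} σ = mk⇔
  (λ inav → Av⇒InAv (appendMax σ) (AppendsMax-Av rel (toWord-bounded σ) (InAv⇒Av σ inav)))
  (λ inav → Av⇒InAv σ (Av-subsequence (λ i → i) (λ i<j _ → i<j) m<n⇒m<1+n (≗-sym (proj₁ rel))
                         (InAv⇒Av (appendMax σ) inav)))
  where rel = appendMax-AppendsMax σ

insertMax-InAv : ∀ {k} (σ : Vec (Fin (suc k)) (suc k)) → InAv312-321 σ ⇔ InAv312-321 (insertMax σ)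
insertMax-InAv {k} σ = mk⇔
  (λ inav → Av⇒InAv (insertMax σ) (InsertsMax-Av rel (toWord-bounded σ) (InAv⇒Av σ inav)))
  (λ inav → Av⇒InAv σ (Av-subsequence skipMax skipMax-mono skipMax-below σ≗v∘skipMax
                         (InAv⇒Av (insertMax σ) inav)))
  where
    rel = insertMax-InsertsMax σ
    skipMax = extend (λ i → i) k (suc k)
    skipMax-< : ∀ {i} → i < k → skipMax i ≡ i
    skipMax-< = extend-< _ k _
    skipMax-mono : ∀ {i j} → i < j → j < suc k → skipMax i < skipMax j
    skipMax-mono {i} i<j j<1+k with <-suc-cases j<1+k
    ... | inj₁ j<k = subst₂ _<_ (sym (skipMax-< (<-trans i<j j<k))) (sym (skipMax-< j<k)) i<j
    ... | inj₂ refl = subst₂ _<_ (sym (skipMax-< i<j)) (sym (extend-at _ k _)) (m<n⇒m<1+n i<j)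
    skipMax-below : Below (suc k) skipMax (suc (suc k))
    skipMax-below i<1+k with <-suc-cases i<1+k
    ... | inj₁ i<k = subst (_< _) (sym (skipMax-< i<k)) (m<n⇒m<1+n (m<n⇒m<1+n i<k))
    ... | inj₂ refl = subst (_< suc (suc k)) (sym (extend-at _ k _)) ≤-refl
    σ≗v∘skipMax : toWord σ ≗[< suc k ] (toWord (insertMax σ) ∘ skipMax)
    σ≗v∘skipMax i<1+k with <-suc-cases i<1+k | rel
    ... | inj₁ i<k | v≗w , _ = trans (sym (v≗w i<k)) (cong (toWord (insertMax σ)) (sym (skipMax-< i<k)))
    ... | inj₂ refl | _ , _ , v1+k≡wk =
      trans (sym v1+k≡wk) (cong (toWord (insertMax σ)) (sym (extend-at _ k _)))

AvLIS : ℕ → ∀ {k} → Vec (Fin k) k → Set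
AvLIS n π = InAv312-321 π × LIS≡ π n

appendMax-AvLIS : ∀ {k n} (σ : Vec (Fin k) k) → AvLIS n σ ⇔ AvLIS (suc n) (appendMax σ)
appendMax-AvLIS σ = ×-⇔-dependent (appendMax-InAv σ) λ _ →
  LIS≡-transfer {π = σ} {σ = appendMax σ} (HasIncSub-appendMax _) (HasIncSub-appendMax _)
  where
    HasIncSub-appendMax : ∀ m → HasIncSub σ m ⇔ HasIncSub (appendMax σ) (suc m)
    HasIncSub-appendMax m =
      HasIncSub-⇔ σ (appendMax σ) (AppendsMax-IncSub (appendMax-AppendsMax σ) (toWord-bounded σ))

insertMax-AvLIS-maxLast : ∀ {k n} (σ : Vec (Fin (suc k)) (suc k)) → EndsWithMax σ →
                          AvLIS n σ ⇔ AvLIS n (insertMax σ)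
insertMax-AvLIS-maxLast σ endsWithMax = ×-⇔-dependent (insertMax-InAv σ) λ inav →
  LIS≡-transfer {π = σ} {σ = insertMax σ} (HasIncSub-insertMax inav) (HasIncSub-insertMax inav)
  where
    HasIncSub-insertMax : ∀ {m} → InAv312-321 σ → HasIncSub σ m ⇔ HasIncSub (insertMax σ) m
    HasIncSub-insertMax inav = HasIncSub-⇔ σ (insertMax σ)
      (InsertsMax-IncSub-maxLast (insertMax-InsertsMax σ) (InAv⇒Av σ inav) (toWord-bounded σ) endsWithMax)

insertMax-AvLIS-maxPenultimate : ∀ {k n} (σ : Vec (Fin (suc k)) (suc k)) → ¬ EndsWithMax σ →
                                 AvLIS n σ ⇔ AvLIS (suc n) (insertMax σ)
insertMax-AvLIS-maxPenultimate {zero} σ ¬endsWithMax = ⊥-elim (¬endsWithMax (EndsWithMax-singleton σ))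
insertMax-AvLIS-maxPenultimate {suc j} σ ¬endsWithMax = ×-⇔-dependent (insertMax-InAv σ) λ inav →
  LIS≡-transfer {π = σ} {σ = insertMax σ} (HasIncSub-insertMax inav) (HasIncSub-insertMax inav)
  where
    HasIncSub-insertMax : ∀ {m} → InAv312-321 σ → HasIncSub σ m ⇔ HasIncSub (insertMax σ) (suc m)
    HasIncSub-insertMax inav = HasIncSub-⇔ σ (insertMax σ)
      (InsertsMax-IncSub-maxPenultimate (insertMax-InsertsMax σ) (InAv⇒Av σ inav) (toWord-bounded σ) ¬endsWithMax)

appendMax-surjective : ∀ {k} (π : Vec (Fin (suc k)) (suc k)) → InAv312-321 π → EndsWithMax π →
                       Σ (Vec (Fin k) k) λ σ → π ≡ appendMax σ
appendMax-surjective {k} π inav endsWithMax =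
  σ , toWord-injective (AppendsMax-functional π-rel (appendMax-AppendsMax σ))
  where
    bounded : Bounded k (toWord π)
    bounded i<k = others-below-max (proj₁ (InAv⇒Av π inav)) (toWord-bounded π) ≤-refl endsWithMax
                    (m<n⇒m<1+n i<k) (<⇒≢ i<k)
    σ = fromWord k (toWord π) bounded
    π-rel : AppendsMax k (toWord σ) (toWord π)
    π-rel = ≗-sym (toWord-fromWord k (toWord π) bounded) , endsWithMax

insertMax-surjective : ∀ {k} (π : Vec (Fin (suc (suc k))) (suc (suc k))) → InAv312-321 π → ¬ EndsWithMax π →
                       Σ (Vec (Fin (suc k)) (suc k)) λ σ → π ≡ insertMax σ
insertMax-surjective {k} π inav ¬endsWithMax =
  σ , toWord-injective (InsertsMax-functional π-rel (insertMax-InsertsMax σ))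
  where
    av = InAv⇒Av π inav
    w = toWord π
    wk≡1+k : w k ≡ suc k
    wk≡1+k = max-penultimate av (toWord-bounded π) ¬endsWithMax
    below-max : ∀ {i} → i < suc (suc k) → i ≢ k → w i < suc k
    below-max = others-below-max (proj₁ av) (toWord-bounded π) (m<n⇒m<1+n ≤-refl) wk≡1+k
    u = extend w k (w (suc k))
    u-bounded : Bounded (suc k) u
    u-bounded i<1+k with <-suc-cases i<1+k
    ... | inj₁ i<k =
      subst (_< suc k) (sym (extend-< w k _ i<k)) (below-max (m<n⇒m<1+n (m<n⇒m<1+n i<k)) (<⇒≢ i<k))
    ... | inj₂ refl = subst (_< suc k) (sym (extend-at w k _)) (below-max ≤-refl (λ ()))
    σ = fromWord (suc k) u u-bounded
    σ≗u = toWord-fromWord (suc k) u u-bounded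
    π-rel : InsertsMax k (toWord σ) w
    π-rel = (λ i<k → trans (sym (extend-< w k _ i<k)) (sym (σ≗u (m<n⇒m<1+n i<k)))) ,
            wk≡1+k ,
            trans (sym (extend-at w k _)) (sym (σ≗u ≤-refl))

MaxLast : ℕ → ∀ {k} → Vec (Fin (suc k)) (suc k) → Set
MaxLast n π = AvLIS n π × EndsWithMax π

MaxPenultimate : ℕ → ∀ {k} → Vec (Fin (suc k)) (suc k) → Set
MaxPenultimate n π = AvLIS n π × ¬ EndsWithMax π

MaxLast-disjoint : ∀ {n n′ k} (π : Vec (Fin (suc k)) (suc k)) → MaxLast n π → ¬ MaxPenultimate n′ π
MaxLast-disjoint _ (_ , endsWithMax) (_ , ¬endsWithMax) = ¬endsWithMax endsWithMax

appendMax-image : ∀ {k n} (π : Vec (Fin (suc k)) (suc k)) →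
                  (Σ (Vec (Fin k) k) λ σ → AvLIS n σ × π ≡ appendMax σ) ⇔ MaxLast (suc n) π
appendMax-image π = mk⇔
  (λ { (σ , avLIS , refl) → Equivalence.to (appendMax-AvLIS σ) avLIS , appendMax-EndsWithMax σ })
  (λ (avLIS , endsWithMax) →
     let σ , π≡σ⁺ = appendMax-surjective π (proj₁ avLIS) endsWithMax
     in σ , Equivalence.from (appendMax-AvLIS σ) (subst (AvLIS _) π≡σ⁺ avLIS) , π≡σ⁺)

insertMax-image : ∀ {k n} (π : Vec (Fin (suc (suc k))) (suc (suc k))) →
                  (Σ (Vec (Fin (suc k)) (suc k)) λ σ → (MaxLast (suc n) σ ⊎ MaxPenultimate n σ) × π ≡ insertMax σ)
                  ⇔ MaxPenultimate (suc n) π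
insertMax-image {k} π = mk⇔
  (λ { (σ , inj₁ (avLIS , endsWithMax) , refl) →
         Equivalence.to (insertMax-AvLIS-maxLast σ endsWithMax) avLIS , insertMax-¬EndsWithMax σ
     ; (σ , inj₂ (avLIS , ¬endsWithMax) , refl) →
         Equivalence.to (insertMax-AvLIS-maxPenultimate σ ¬endsWithMax) avLIS , insertMax-¬EndsWithMax σ })
  (λ (avLIS , ¬endsWithMax) →
     let σ , π≡σ⁺ = insertMax-surjective π (proj₁ avLIS) ¬endsWithMax
         avLIS′ = subst (AvLIS _) π≡σ⁺ avLIS
     in σ , classify σ avLIS′ , π≡σ⁺)
  where
    classify : ∀ {n} (σ : Vec (Fin (suc k)) (suc k)) → AvLIS (suc n) (insertMax σ) →
               MaxLast (suc n) σ ⊎ MaxPenultimate n σ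
    classify σ avLIS with toWord σ k ≟ k
    ... | yes endsWithMax = inj₁ (Equivalence.from (insertMax-AvLIS-maxLast σ endsWithMax) avLIS , endsWithMax)
    ... | no ¬endsWithMax =
      inj₂ (Equivalence.from (insertMax-AvLIS-maxPenultimate σ ¬endsWithMax) avLIS , ¬endsWithMax)

-- The first clause splits on k alone, so that count n (suc k) unfolds for a variable n.
mutual
  count : ℕ → ℕ → ℕ
  count n (suc k) = countMaxLast n k + countMaxPenultimate n k
  count zero zero = 1
  count (suc n) zero = 0

  countMaxLast : ℕ → ℕ → ℕ
  countMaxLast zero k = 0
  countMaxLast (suc n) k = count n k

  countMaxPenultimate : ℕ → ℕ → ℕ
  countMaxPenultimate zero k = 0
  countMaxPenultimate (suc n) zero = 0
  countMaxPenultimate (suc n) (suc k) = countMaxLast (suc n) k + countMaxPenultimate n k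

¬LIS≡0 : ∀ {k} (π : Vec (Fin (suc k)) (suc k)) → ¬ LIS≡ π 0
¬LIS≡0 π (_ , ¬longer) = ¬longer (Fin.zero ∷ [] , tt , tt)

AvLIS-empty : AvLIS 0 []
AvLIS-empty = ((λ ()) , (λ ()) , (λ ())) , ([] , tt , tt) , λ { (() ∷ _ , _) }

mutual
  count-correct : ∀ n k → HasCount (AvLIS n {k}) (count n k)
  count-correct zero zero = HasCount-singleton [] (λ { [] → mk⇔ (λ _ → AvLIS-empty) (λ _ → refl) })
  count-correct (suc n) zero = HasCount-none λ { [] (_ , (() ∷ _ , _) , _) }
  count-correct n (suc k) = HasCount-⇔ split
    (HasCount-⊎ MaxLast-disjoint (countMaxLast-correct n k) (countMaxPenultimate-correct n k))
    where
      split : (π : Vec (Fin (suc k)) (suc k)) → (MaxLast n π ⊎ MaxPenultimate n π) ⇔ AvLIS n π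
      split π = mk⇔ [ proj₁ , proj₁ ] λ avLIS → ⊎.map (avLIS ,_) (avLIS ,_) (toSum (toWord π k ≟ k))

  countMaxLast-correct : ∀ n k → HasCount (MaxLast n {k}) (countMaxLast n k)
  countMaxLast-correct zero k = HasCount-none λ π (avLIS , _) → ¬LIS≡0 π (proj₂ avLIS)
  countMaxLast-correct (suc n) k =
    HasCount-⇔ appendMax-image (HasCount-image appendMax appendMax-injective (count-correct n k))

  countMaxPenultimate-correct : ∀ n k → HasCount (MaxPenultimate n {k}) (countMaxPenultimate n k)
  countMaxPenultimate-correct zero k = HasCount-none λ π (avLIS , _) → ¬LIS≡0 π (proj₂ avLIS)
  countMaxPenultimate-correct (suc n) zero = HasCount-none λ π (_ , ¬endsWithMax) →
    ¬endsWithMax (EndsWithMax-singleton π)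
  countMaxPenultimate-correct (suc n) (suc k) =
    HasCount-⇔ insertMax-image (HasCount-image insertMax insertMax-injective
      (HasCount-⊎ MaxLast-disjoint (countMaxLast-correct (suc n) k) (countMaxPenultimate-correct n k)))

count-recurrence : ∀ m k → count (suc (suc m)) (suc (suc k)) + count m k
                         ≡ (count (suc m) (suc k) + count (suc m) (suc k)) + count (suc m) k
-- Both sides unfold to sums of count m k, countMaxPenultimate (suc m) k and count (suc m) k.
count-recurrence m k = rearrange (count m k) (countMaxPenultimate (suc m) k) (count (suc m) k)
  where
    open +-*-Solver
    rearrange : ∀ c n b → ((c + n) + (b + n)) + c ≡ ((c + n) + (c + n)) + b
    rearrange = solve 3 (λ c n b → ((c :+ n) :+ (b :+ n)) :+ c := ((c :+ n) :+ (c :+ n)) :+ b) refl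

+-difference : ∀ {x y c} → x + c ≡ y → + x ≡ + y ℤ.- + c
+-difference {x} {c = c} refl = sym (begin
  + (x + c) ℤ.- + c   ≡⟨ [+m]-[+n]≡m⊖n (x + c) c ⟩
  (x + c) ℤ.⊖ c       ≡⟨ ⊖-≥ (m≤n+m c x) ⟩
  + (x + c ∸ c)       ≡⟨ cong +_ (m+n∸n≡m x c) ⟩
  + x                 ∎)
  where open ≡-Reasoning

mainTheorem8 : Σ (ℕ → FPS) λ p → IsGF-p p ×
    (∀ k → p 0 k ≡ poly (+ 1 ∷ []) k) ×
    (∀ k → p 1 k ≡ poly (+ 0 ∷ + 1 ∷ + 1 ∷ []) k) ×
    (∀ m k → p (suc (suc m)) k
        ≡ (((t^ 1 · (p (suc m) ⊕ p (suc m))) ⊕ (t^ 2 · p (suc m))) ⊖ (t^ 2 · p m)) k)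
mainTheorem8 = p , (λ n k → count n k , refl , count-correct n k) , p₀ , p₁ , recurrence
  where
    p : ℕ → FPS
    p n k = + count n k
    p₀ : ∀ k → p 0 k ≡ poly (+ 1 ∷ []) k
    p₀ zero = refl
    p₀ (suc k) = refl
    p₁ : ∀ k → p 1 k ≡ poly (+ 0 ∷ + 1 ∷ + 1 ∷ []) k
    p₁ zero = refl
    p₁ (suc zero) = refl
    p₁ (suc (suc zero)) = refl
    p₁ (suc (suc (suc k))) = refl
    recurrence : ∀ m k → p (suc (suc m)) k
               ≡ (((t^ 1 · (p (suc m) ⊕ p (suc m))) ⊕ (t^ 2 · p (suc m))) ⊖ (t^ 2 · p m)) k
    recurrence m zero = refl
    recurrence m (suc zero) = refl
    recurrence m (suc (suc k)) = +-difference (count-recurrence m k)
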